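{- Let $G=(V,E)$ be a graph, $b$ a positive integer, and $M_1$ a matching in $G$. Let $(L,R)$ be a partition of $V$ in which every edge of $M_1$ has one endpoint in $L$ and one in $R$. Let $E_2$ be the set of edges $(u,v)\in E$ with $u\in V(M_1)$, $v\notin V(M_1)$, and $u,v$ on different sides of $(L,R)$, and let $M_2$ be a maximal $b$-matching in $(V,E_2)$ with capacity $1$ on $V(M_1)$ and capacity $b$ on $V\setminus V(M_1)$. Let $\mathcal P$ be a set of $3$-augmenting paths with respect to $M_1$ in $G[M_1\cup M_2]$ such that each vertex of $V(M_1)$ belongs to at most one path of $\mathcal P$ and each vertex of $V\setminus V(M_1)$ belongs to at most $b$ paths of $\mathcal P$. Then $\mathcal P$ contains a subset $\mathcal P'$ of pairwise vertex-disjoint paths with $|\mathcal P'|\ge\frac1b|\mathcal P|$.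
   Context: $V(M)$ is the set of endpoints of edges of a matching $M$; $G[F]$ is the subgraph formed by the edge set $F$. A $b$-matching with capacities $\{b_v\}$ is a multiset of edges in which each vertex $v$ is in at most $b_v$ elements; maximal means no edge copy can be added while respecting capacities. A $3$-augmenting path w.r.t. $M_1$ is a path $u'-u-v-v'$ with $(u,v)\in M_1$ and $u',v'$ distinct vertices unmatched by $M_1$. -}

module Defs where

open import Data.Nat using (ℕ; zero; suc; _+_; _*_; _≤_; _<_)
open import Data.Fin using (Fin)
open import Data.Fin.Properties using (_≟_)
open import Data.Bool using (Bool)
open import Data.Product using (_×_; _,_; ∃)
open import Data.Sum using (_⊎_)
open import Data.List using (List; []; _∷_; length; filter)
open import Data.List.Membership.Propositional using (_∈_)
open import Data.List.Relation.Unary.Unique.Propositional using (Unique)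
open import Data.List.Relation.Unary.AllPairs using (AllPairs)
open import Data.List.Relation.Binary.Sublist.Propositional using (_⊆_)
open import Data.List.Relation.Binary.Disjoint.Propositional using (Disjoint)
open import Relation.Nullary using (¬_; Dec; yes; no)
open import Relation.Binary.PropositionalEquality using (_≡_; _≢_)

record Graph (n : ℕ) : Set₁ where
  field
    Adj   : Fin n → Fin n → Set
    sym   : ∀ {u v} → Adj u v → Adj v u
    irrefl : ∀ {u} → ¬ Adj u u
open Graph public

record Matching {n : ℕ} (G : Graph n) : Set₁ where
  field
    M      : Fin n → Fin n → Set
    sym    : ∀ {u v} → M u v → M v u
    ⊆E     : ∀ {u v} → M u v → Adj G u v
    unique : ∀ {u v w} → M u v → M u w → v ≡ w
open Matching public

VM : ∀ {n} {G : Graph n} → Matching G → Fin n → Set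
VM M₁ u = ∃ λ v → M M₁ u v

-- Every edge of E₂ has exactly one endpoint in V(M₁), so we record E₂-edges
-- canonically as ordered pairs (matched endpoint , unmatched endpoint).
E₂ : ∀ {n} (G : Graph n) (M₁ : Matching G) (side : Fin n → Bool) → Fin n → Fin n → Set
E₂ G M₁ side u v = Adj G u v × VM M₁ u × ¬ VM M₁ v × side u ≢ side v

deg : ∀ {n} → Fin n → List (Fin n × Fin n) → ℕ
deg w [] = 0
deg w ((x , y) ∷ es) with x ≟ w | y ≟ w
... | yes _ | _     = suc (deg w es)
... | no _  | yes _ = suc (deg w es)
... | no _  | no _  = deg w es

record Capacity {n} {G : Graph n} (M₁ : Matching G) (b : ℕ) (w : Fin n) (k : ℕ) : Set where
  field
    onVM  : VM M₁ w → k ≤ 1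
    offVM : ¬ VM M₁ w → k ≤ b

-- A maximal b-matching in (V, E₂) with the above capacities:
-- a multiset (list) of E₂-edges respecting capacities, to which no further
-- copy of an E₂-edge can be added without violating a capacity.
record MaximalBMatching {n} (G : Graph n) (M₁ : Matching G) (side : Fin n → Bool)
                        (b : ℕ) (M₂ : List (Fin n × Fin n)) : Set where
  field
    inE₂     : ∀ {u v} → (u , v) ∈ M₂ → E₂ G M₁ side u v
    capacity : ∀ w → Capacity M₁ b w (deg w M₂)
    maximal  : ∀ u v → E₂ G M₁ side u v →
               ¬ (Capacity M₁ b u (suc (deg u M₂)) × Capacity M₁ b v (suc (deg v M₂)))

InM₁₂ : ∀ {n} {G : Graph n} → Matching G → List (Fin n × Fin n) → Fin n → Fin n → Set
InM₁₂ M₁ M₂ x y = M M₁ x y ⊎ (x , y) ∈ M₂ ⊎ (y , x) ∈ M₂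

record Path3 (n : ℕ) : Set where
  constructor path
  field
    u' u v v' : Fin n
open Path3 public

verts : ∀ {n} → Path3 n → List (Fin n)
verts p = u' p ∷ u p ∷ v p ∷ v' p ∷ []

record Aug3 {n} {G : Graph n} (M₁ : Matching G) (M₂ : List (Fin n × Fin n)) (p : Path3 n) : Set where
  field
    e₁     : InM₁₂ M₁ M₂ (u' p) (u p)
    e₂     : InM₁₂ M₁ M₂ (u p) (v p)
    e₃     : InM₁₂ M₁ M₂ (v p) (v' p)
    mid∈M₁ : M M₁ (u p) (v p)
    u'free : ¬ VM M₁ (u' p)
    v'free : ¬ VM M₁ (v' p)
    u'≢v'  : u' p ≢ v' p

load : ∀ {n} → Fin n → List (Path3 n) → ℕ
load {n} w P = length (filter (λ p → w ∈F? verts p) P)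
  where open import Data.List.Membership.DecPropositional (_≟_ {n}) using () renaming (_∈?_ to _∈F?_)

VertexDisjoint : ∀ {n} → Path3 n → Path3 n → Set
VertexDisjoint p q = Disjoint (verts p) (verts q)

-- The free endpoints of a 3-augmenting path lie on opposite sides of (L, R): every
-- edge of M₁ ∪ M₂ crosses the partition and the path has three edges.  Two paths
-- of 𝒫 that meet do so in a vertex outside V(M₁) (vertices of V(M₁) lie on at
-- most one path), hence in a common L-endpoint or a common R-endpoint.  So 𝒫 is
-- the edge set of a bipartite multigraph, joining the L-endpoint of each path to
-- its R-endpoint, whose degrees are at most b, and vertex-disjoint sets of paths
-- are matchings of it.  By König's edge-colouring theorem, proved with Kempe
-- chains, 𝒫 splits into b matchings, and the largest has at least |𝒫|/b paths.
module Submission where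

open import Defs hiding (sym)
open import Data.Bool using (Bool; true; false; not)
import Data.Bool.Properties as Bool
open import Data.Empty using (⊥-elim)
open import Data.Fin using (Fin; toℕ; fromℕ<)
open import Data.Fin.Properties
  using (toℕ<n; toℕ-injective; ¬∀⟶∃¬; injective⇒≤) renaming (_≟_ to _≟ᶠ_)
open import Data.Fin.Permutation.Components using (transpose; transpose-inverse)
open import Data.List using (List; []; _∷_; length; filter; map; lookup)
open import Data.List.Properties
  using (filter-accept; filter-all; filter-none; length-filter; length-map)
open import Data.List.Membership.Propositional using (_∈_; _∉_; find; lose)
open import Data.List.Membership.Propositional.Properties using (∈-filter⁺; ∈-filter⁻; ∈-map⁺)
open import Data.List.Relation.Unary.Any using (Any; here; there; any?)
open import Data.List.Relation.Unary.Any.Properties using (lookup-index)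
open import Data.List.Relation.Unary.All as All using (All)
open import Data.List.Relation.Unary.AllPairs using (AllPairs; []; _∷_)
open import Data.List.Relation.Unary.Unique.Propositional using (Unique)
import Data.List.Relation.Unary.Unique.Propositional.Properties as Unique
open import Data.List.Relation.Binary.Sublist.Propositional using (_⊆_; _∷ʳ_; ⊆-refl)
open import Data.List.Relation.Binary.Sublist.Propositional.Properties using (Any-resp-⊆; filter-⊆)
open import Data.List.Relation.Binary.Sublist.Heterogeneous.Properties
  using (length-mono-≤; ⊆-filter-Sublist)
import Data.List.Membership.DecPropositional as DecMembership
open import Data.Nat using (ℕ; zero; suc; _+_; _*_; _≤_; _<_; z≤n; s≤s; NonZero; >-nonZero; >-nonZero⁻¹)
open import Data.Nat.Properties
  using (≤-trans; ≤-refl; ≤-reflexive; ≤-total; _≤?_; _<?_; <-irrefl;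
         1+n≰n; m≤n⇒m≤1+n; m<n⇒m<1+n; m<1+n⇒m<n∨m≡n; n<1+n; <⇒≱; +-suc; +-comm; +-mono-≤; +-monoˡ-≤;
         *-monoʳ-≤; module ≤-Reasoning)
  renaming (_≟_ to _≟ⁿ_)
open import Data.Product using (_×_; _,_; ∃; Σ; proj₁; proj₂)
open import Data.Product.Properties using (≡-dec)
open import Data.Sum using (_⊎_; inj₁; inj₂)
open import Function using (_∘_)
open import Level using (Level)
open import Relation.Nullary using (¬_; Dec; yes; no; ¬?; contradiction)
open import Relation.Nullary.Decidable using (_×-dec_; _⊎-dec_; map′; decidable-stable; dec-true)
open import Relation.Unary using (Pred; Decidable)
open import Relation.Binary.Definitions using (DecidableEquality)
open import Relation.Binary.PropositionalEquality
  using (_≡_; _≢_; refl; sym; trans; cong; subst; module ≡-Reasoning)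

private variable
  ℓ : Level
  A : Set

count : {P : Pred A ℓ} → Decidable P → List A → ℕ
count P? xs = length (filter P? xs)

AllPairs-mapWith∈ : ∀ {R S : A → A → Set} {xs} →
                    (∀ {a b} → a ∈ xs → b ∈ xs → R a b → S a b) → AllPairs R xs → AllPairs S xs
AllPairs-mapWith∈ R⇒S []         = []
AllPairs-mapWith∈ R⇒S (Rx ∷ Rxs) =
  All.tabulate (λ b∈ → R⇒S (here refl) (there b∈) (All.lookup Rx b∈))
  ∷ AllPairs-mapWith∈ (λ a∈ b∈ → R⇒S (there a∈) (there b∈)) Rxs

two-distinct-members : ∀ {a b : A} {xs} → a ∈ xs → b ∈ xs → a ≢ b → 2 ≤ length xs
two-distinct-members (here refl)       (here refl)       a≢b = ⊥-elim (a≢b refl)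
two-distinct-members (here _)          (there (here _))  _   = s≤s (s≤s z≤n)
two-distinct-members (here _)          (there (there _)) _   = s≤s (s≤s z≤n)
two-distinct-members (there (here _))  (here _)          _   = s≤s (s≤s z≤n)
two-distinct-members (there (there _)) (here _)          _   = s≤s (s≤s z≤n)
two-distinct-members (there a∈)        (there b∈)        a≢b = m≤n⇒m≤1+n (two-distinct-members a∈ b∈ a≢b)

∈-∷-≢ : ∀ {a b : A} {xs} → a ∈ b ∷ xs → a ≢ b → a ∈ xs
∈-∷-≢ (here a≡b) a≢b = contradiction a≡b a≢b
∈-∷-≢ (there a∈) _   = a∈

module _ {P Q : Pred A ℓ} (P? : Decidable P) (Q? : Decidable Q) (P⇒Q : ∀ {a} → P a → Q a) where

  count-mono : ∀ {xs ys} → xs ⊆ ys → count P? xs ≤ count Q? ys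
  count-mono xs⊆ys = length-mono-≤ (⊆-filter-Sublist P? Q? (λ { refl → P⇒Q }) xs⊆ys)

  count-strict-mono : ∀ {xs} → Any (λ a → Q a × ¬ P a) xs → count P? xs < count Q? xs
  count-strict-mono {a ∷ xs} (here (Qa , ¬Pa)) with P? a | Q? a
  ... | yes Pa | _      = contradiction Pa ¬Pa
  ... | no _   | yes _  = s≤s (count-mono (⊆-refl {x = xs}))
  ... | no _   | no ¬Qa = contradiction Qa ¬Qa
  count-strict-mono {a ∷ xs} (there new) with P? a | Q? a
  ... | yes Pa | no ¬Qa = contradiction (P⇒Q Pa) ¬Qa
  ... | yes _  | yes _  = s≤s (count-strict-mono new)
  ... | no _   | yes _  = m≤n⇒m≤1+n (count-strict-mono new)
  ... | no _   | no _   = count-strict-mono new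

-- Until the chain stabilises on xs, the number of elements of xs satisfying P k grows with k.
module _ {P : ℕ → Pred A ℓ} (P? : ∀ k → Decidable (P k))
         (P-mono : ∀ {k a} → P k a → P (suc k) a) (xs : List A) where

  StableAt : ℕ → Set ℓ
  StableAt N = ∀ {a} → a ∈ xs → P (suc N) a → P N a

  private
    stable-or-growing : ∀ k → ∃ StableAt ⊎ k ≤ count (P? k) xs
    stable-or-growing zero = inj₂ z≤n
    stable-or-growing (suc k) with stable-or-growing k
    ... | inj₁ stable = inj₁ stable
    ... | inj₂ growing with any? (λ a → P? (suc k) a ×-dec ¬? (P? k a)) xs
    ...   | yes new  = inj₂ (≤-trans (s≤s growing) (count-strict-mono (P? k) (P? (suc k)) P-mono new))
    ...   | no ¬new = inj₁ (k , λ {a} a∈ Pa → decidable-stable (P? k a) (λ ¬Pa → ¬new (lose a∈ (Pa , ¬Pa))))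

  stabilises : ∃ StableAt
  stabilises with stable-or-growing (suc (length xs))
  ... | inj₁ stable  = stable
  ... | inj₂ growing = contradiction (≤-trans growing (length-filter (P? _) xs)) 1+n≰n

module _ {P Q R : Pred A ℓ} (P? : Decidable P) (Q? : Decidable Q) (R? : Decidable R)
         (P⇒Q⊎R : ∀ {a} → P a → Q a ⊎ R a) (Q⇒P : ∀ {a} → Q a → P a) (R⇒P : ∀ {a} → R a → P a)
         (Q⇒¬R : ∀ {a} → Q a → ¬ R a) where

  count-split : ∀ xs → count P? xs ≡ count Q? xs + count R? xs
  count-split []       = refl
  count-split (a ∷ xs) with P? a | Q? a | R? a
  ... | yes _  | yes _  | no _   = cong suc (count-split xs)
  ... | yes _  | no _   | yes _  = trans (cong suc (count-split xs)) (sym (+-suc _ _))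
  ... | no _   | no _   | no _   = count-split xs
  ... | _      | yes Qa | yes Ra = contradiction Ra (Q⇒¬R Qa)
  ... | no ¬Pa | yes Qa | _      = contradiction (Q⇒P Qa) ¬Pa
  ... | no ¬Pa | _      | yes Ra = contradiction (R⇒P Ra) ¬Pa
  ... | yes Pa | no ¬Qa | no ¬Ra with P⇒Q⊎R Pa
  ...   | inj₁ Qa = contradiction Qa ¬Qa
  ...   | inj₂ Ra = contradiction Ra ¬Ra

module _ (g : A → ℕ) where
  open ≤-Reasoning

  count-<-suc : ∀ m xs → count (λ a → g a <? suc m) xs ≡ count (λ a → g a <? m) xs + count (λ a → g a ≟ⁿ m) xs
  count-<-suc m = count-split (λ a → g a <? suc m) (λ a → g a <? m) (λ a → g a ≟ⁿ m)
    m<1+n⇒m<n∨m≡n m<n⇒m<1+n (λ { refl → n<1+n _ }) (λ g<m g≡m → <-irrefl g≡m g<m)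

  fibre-size : List A → ℕ → ℕ
  fibre-size xs k = count (λ a → g a ≟ⁿ k) xs

  largest-fibre : ∀ xs m → ∃ λ k → count (λ a → g a <? m) xs ≤ m * fibre-size xs k
  largest-fibre xs zero = 0 , ≤-reflexive (cong length (filter-none (λ a → g a <? 0) {xs} (All.tabulate λ _ ())))
  largest-fibre xs (suc m) with largest-fibre xs m
  ... | k , below-m with ≤-total (fibre-size xs k) (fibre-size xs m)
  ...   | inj₁ k≤m = m , (begin
          count (λ a → g a <? suc m) xs  ≡⟨ count-<-suc m xs ⟩
          count (λ a → g a <? m) xs + fibre-size xs m
            ≤⟨ +-monoˡ-≤ (fibre-size xs m) (≤-trans below-m (*-monoʳ-≤ m k≤m)) ⟩
          m * fibre-size xs m + fibre-size xs m    ≡⟨ +-comm (m * fibre-size xs m) (fibre-size xs m) ⟩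
          suc m * fibre-size xs m             ∎)
  ...   | inj₂ m≤k = k , (begin
          count (λ a → g a <? suc m) xs  ≡⟨ count-<-suc m xs ⟩
          count (λ a → g a <? m) xs + fibre-size xs m  ≤⟨ +-mono-≤ below-m m≤k ⟩
          m * fibre-size xs k + fibre-size xs k    ≡⟨ +-comm (m * fibre-size xs k) (fibre-size xs k) ⟩
          suc m * fibre-size xs k             ∎)

large-colour-class : ∀ {b} (c : A → Fin b) xs → ∃ λ k → length xs ≤ b * count (λ a → toℕ (c a) ≟ⁿ k) xs
large-colour-class {b = b} c xs with largest-fibre (toℕ ∘ c) xs b
... | k , large = k , subst (_≤ b * fibre-size (toℕ ∘ c) xs k) everything-below-b large
  where
  everything-below-b : count (λ a → toℕ (c a) <? b) xs ≡ length xs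
  everything-below-b = cong length (filter-all (λ a → toℕ (c a) <? b) {xs} (All.tabulate λ _ → toℕ<n _))

-- If every α : Fin b occurred in xs, sending α to its position would inject Fin b into Fin |xs|.
missing-element : ∀ {b} (xs : List (Fin b)) → length xs < b → ∃ λ α → α ∉ xs
missing-element {b} xs |xs|<b = ¬∀⟶∃¬ b (_∈ xs) (λ α → DecMembership._∈?_ _≟ᶠ_ α xs)
  λ all∈ → <⇒≱ |xs|<b (injective⇒≤ (λ {α} {β} same-index →
    trans (lookup-index (all∈ α)) (trans (cong (lookup xs) same-index) (sym (lookup-index (all∈ β))))))

transpose-matchˡ : ∀ {b} (i j : Fin b) → transpose i j i ≡ j
transpose-matchˡ i j rewrite dec-true (i ≟ᶠ i) refl = refl

transpose-matchʳ : ∀ {b} (i j : Fin b) → transpose i j j ≡ i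
transpose-matchʳ i j with j ≟ᶠ i
... | yes refl = refl
... | no _ rewrite dec-true (j ≟ᶠ j) refl = refl

transpose-injective : ∀ {b} (i j : Fin b) {k l} → transpose i j k ≡ transpose i j l → k ≡ l
transpose-injective i j {k} {l} eq =
  trans (sym (transpose-inverse j i)) (trans (cong (transpose j i) eq) (transpose-inverse j i))

-- A bipartite multigraph on the sides X and Y: the edge e joins x e to y e.
module BipartiteEdgeColouring
  {X Y : Set} (_≟ᴬ_ : DecidableEquality A) (_≟ˣ_ : DecidableEquality X) (_≟ʸ_ : DecidableEquality Y)
  (x : A → X) (y : A → Y) (b : ℕ) .{{_ : NonZero b}} where

  Adjacent : A → A → Set
  Adjacent e f = x e ≡ x f ⊎ y e ≡ y f

  Proper : (A → Fin b) → List A → Set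
  Proper c E = ∀ {e f} → e ∈ E → f ∈ E → e ≢ f → Adjacent e f → c e ≢ c f

  Missing : {V : Set} → (A → V) → (A → Fin b) → List A → V → Fin b → Set
  Missing end c E w α = ∀ {f} → f ∈ E → end f ≡ w → c f ≢ α

  module _ {V : Set} (_≟_ : DecidableEquality V) (end : A → V) where

    at? : ∀ w → Decidable (λ e → end e ≡ w)
    at? w e = end e ≟ w

    degree : V → List A → ℕ
    degree w = count (at? w)

    degree-∷ : ∀ w e E → degree w E ≤ degree w (e ∷ E)
    degree-∷ w e E = count-mono (at? w) (at? w) (λ eq → eq) {E} (e ∷ʳ ⊆-refl)

    degree-∷-self : ∀ e E → degree (end e) (e ∷ E) ≡ suc (degree (end e) E)
    degree-∷-self e E = cong length (filter-accept (at? (end e)) refl)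

    missing-colour : ∀ c E w → degree w E < b → ∃ (Missing end c E w)
    missing-colour c E w deg<b
      with missing-element (map c (filter (at? w) E)) (subst (_< b) (sym (length-map c (filter (at? w) E))) deg<b)
    ... | α , α∉ = α , λ f∈ end≡w cf≡α → α∉ (subst (_∈ _) cf≡α (∈-map⁺ c (∈-filter⁺ (at? w) f∈ end≡w)))

  degreeˣ : X → List A → ℕ
  degreeˣ = degree _≟ˣ_ x

  degreeʸ : Y → List A → ℕ
  degreeʸ = degree _≟ʸ_ y

  adjacent-sym : ∀ {e f} → Adjacent e f → Adjacent f e
  adjacent-sym (inj₁ eq) = inj₁ (sym eq)
  adjacent-sym (inj₂ eq) = inj₂ (sym eq)

  proper-adjacent-same-colour : ∀ {c E e f} → Proper c E → e ∈ E → f ∈ E → Adjacent e f → c e ≡ c f → e ≡ f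
  proper-adjacent-same-colour proper e∈ f∈ adj same =
    decidable-stable (_ ≟ᴬ _) (λ e≢f → proper e∈ f∈ e≢f adj same)

  -- Kempe chain: if α is missing at x₀ and β at y₀, swapping α and β on the
  -- α/β-alternating chain that starts with the α-edge at y₀ makes α missing at both.
  module KempeSwap (E : List A) (c : A → Fin b) (proper : Proper c E)
                   {α β : Fin b} (α≢β : α ≢ β) {x₀ : X} {y₀ : Y}
                   (α-missing : Missing x c E x₀ α) (β-missing : Missing y c E y₀ β) where

    swap : Fin b → Fin b
    swap = transpose α β

    Step : A → A → Set
    Step f g = (c f ≡ α × c g ≡ β × x f ≡ x g) ⊎ (c f ≡ β × c g ≡ α × y f ≡ y g)

    step? : ∀ f g → Dec (Step f g)
    step? f g = (c f ≟ᶠ α ×-dec c g ≟ᶠ β ×-dec x f ≟ˣ x g) ⊎-dec (c f ≟ᶠ β ×-dec c g ≟ᶠ α ×-dec y f ≟ʸ y g)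

    Reach : ℕ → A → Set
    Reach zero    g = c g ≡ α × y g ≡ y₀
    Reach (suc k) g = Reach k g ⊎ Any (λ f → Reach k f × Step f g) E

    reach? : ∀ k → Decidable (Reach k)
    reach? zero    g = c g ≟ᶠ α ×-dec y g ≟ʸ y₀
    reach? (suc k) g = reach? k g ⊎-dec any? (λ f → reach? k f ×-dec step? f g) E

    start-reached : ∀ {k g} → Reach zero g → Reach k g
    start-reached {zero}  r = r
    start-reached {suc k} r = inj₁ (start-reached r)

    reach-origin : ∀ {k g} → Reach k g → Reach zero g ⊎ ∃ λ f → f ∈ E × Reach k f × Step f g
    reach-origin {zero}  r        = inj₁ r
    reach-origin {suc k} (inj₁ r) with reach-origin r
    ... | inj₁ start               = inj₁ start
    ... | inj₂ (f , f∈ , rf , step) = inj₂ (f , f∈ , inj₁ rf , step)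
    reach-origin {suc k} (inj₂ any) with find any
    ... | f , f∈ , rf , step = inj₂ (f , f∈ , inj₁ rf , step)

    reach-colour : ∀ {k g} → Reach k g → c g ≡ α ⊎ c g ≡ β
    reach-colour r with reach-origin r
    ... | inj₁ (cg≡α , _)                    = inj₁ cg≡α
    ... | inj₂ (_ , _ , _ , inj₁ (_ , cg≡β , _)) = inj₂ cg≡β
    ... | inj₂ (_ , _ , _ , inj₂ (_ , cg≡α , _)) = inj₁ cg≡α

    reach-α : ∀ {k g} → Reach k g → c g ≡ α → y g ≡ y₀ ⊎ ∃ λ h → h ∈ E × Reach k h × c h ≡ β × y h ≡ y g
    reach-α r cg≡α with reach-origin r
    ... | inj₁ (_ , yg≡y₀)                         = inj₁ yg≡y₀
    ... | inj₂ (_ , _ , _ , inj₁ (_ , cg≡β , _))     = contradiction (trans (sym cg≡α) cg≡β) α≢β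
    ... | inj₂ (h , h∈ , rh , inj₂ (ch≡β , _ , yh≡yg)) = inj₂ (h , h∈ , rh , ch≡β , yh≡yg)

    reach-β : ∀ {k g} → Reach k g → c g ≡ β → ∃ λ h → h ∈ E × Reach k h × c h ≡ α × x h ≡ x g
    reach-β r cg≡β with reach-origin r
    ... | inj₁ (cg≡α , _)                          = contradiction (trans (sym cg≡α) cg≡β) α≢β
    ... | inj₂ (h , h∈ , rh , inj₁ (ch≡α , _ , xh≡xg)) = h , h∈ , rh , ch≡α , xh≡xg
    ... | inj₂ (_ , _ , _ , inj₂ (_ , cg≡α , _))     = contradiction (trans (sym cg≡α) cg≡β) α≢β

    N : ℕ
    N = proj₁ (stabilises reach? inj₁ E)

    Chain : A → Set
    Chain = Reach N

    chain-closed : ∀ {g} → g ∈ E → Reach (suc N) g → Chain g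
    chain-closed = proj₂ (stabilises reach? inj₁ E)

    -- Properness gives each vertex at most one α-edge and one β-edge, so the chain is
    -- closed under adjacency within the α/β-edges; this is what makes the swap proper.
    chain-extends : ∀ {e f} → e ∈ E → Chain e → f ∈ E → Adjacent e f → c f ≡ swap (c e) → Chain f
    chain-extends {e} {f} e∈ ch-e f∈ adj cf≡swap with reach-colour ch-e
    ... | inj₁ ce≡α = along adj
      where
      cf≡β : c f ≡ β
      cf≡β = trans cf≡swap (trans (cong swap ce≡α) (transpose-matchˡ α β))
      along : Adjacent e f → Chain f
      along (inj₁ xe≡xf) = chain-closed f∈ (inj₂ (lose e∈ (ch-e , inj₁ (ce≡α , cf≡β , xe≡xf))))
      along (inj₂ ye≡yf) with reach-α ch-e ce≡α
      ... | inj₁ ye≡y₀ = contradiction cf≡β (β-missing f∈ (trans (sym ye≡yf) ye≡y₀))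
      ... | inj₂ (h , h∈ , ch-h , ch≡β , yh≡ye) =
        subst Chain (proper-adjacent-same-colour proper h∈ f∈ (inj₂ (trans yh≡ye ye≡yf)) (trans ch≡β (sym cf≡β))) ch-h
    ... | inj₂ ce≡β = along adj
      where
      cf≡α : c f ≡ α
      cf≡α = trans cf≡swap (trans (cong swap ce≡β) (transpose-matchʳ α β))
      along : Adjacent e f → Chain f
      along (inj₂ ye≡yf) = chain-closed f∈ (inj₂ (lose e∈ (ch-e , inj₂ (ce≡β , cf≡α , ye≡yf))))
      along (inj₁ xe≡xf) with reach-β ch-e ce≡β
      ... | h , h∈ , ch-h , ch≡α , xh≡xe =
        subst Chain (proper-adjacent-same-colour proper h∈ f∈ (inj₁ (trans xh≡xe xe≡xf)) (trans ch≡α (sym cf≡α))) ch-h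

    recolour : A → Fin b
    recolour g with reach? N g
    ... | yes _ = swap (c g)
    ... | no _  = c g

    recolour-proper : Proper recolour E
    recolour-proper {e} {f} e∈ f∈ e≢f adj same with reach? N e | reach? N f
    ... | yes _     | yes _     = proper e∈ f∈ e≢f adj (transpose-injective α β same)
    ... | yes ch-e  | no ¬ch-f  = ¬ch-f (chain-extends e∈ ch-e f∈ adj (sym same))
    ... | no ¬ch-e  | yes ch-f  = ¬ch-e (chain-extends f∈ ch-f e∈ (adjacent-sym adj) same)
    ... | no _      | no _      = proper e∈ f∈ e≢f adj same

    swapped-α-is-not-α : ∀ {g} → c g ≡ α → swap (c g) ≢ α
    swapped-α-is-not-α cg≡α eq = α≢β (trans (sym eq) (trans (cong swap cg≡α) (transpose-matchˡ α β)))

    recolour-missing-x₀ : Missing x recolour E x₀ α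
    recolour-missing-x₀ {f} f∈ xf≡x₀ same with reach? N f
    ... | no _ = α-missing f∈ xf≡x₀ same
    ... | yes ch-f with reach-colour ch-f
    ...   | inj₁ cf≡α = swapped-α-is-not-α cf≡α same
    ...   | inj₂ cf≡β with reach-β ch-f cf≡β
    ...     | h , h∈ , _ , ch≡α , xh≡xf = α-missing h∈ (trans xh≡xf xf≡x₀) ch≡α

    recolour-missing-y₀ : Missing y recolour E y₀ α
    recolour-missing-y₀ {f} f∈ yf≡y₀ same with reach? N f
    ... | no ¬ch-f = ¬ch-f (start-reached (same , yf≡y₀))
    ... | yes ch-f with reach-colour ch-f
    ...   | inj₁ cf≡α = swapped-α-is-not-α cf≡α same
    ...   | inj₂ cf≡β = β-missing f∈ yf≡y₀ cf≡β

  assign : (A → Fin b) → A → Fin b → A → Fin b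
  assign c e α g with g ≟ᴬ e
  ... | yes _ = α
  ... | no _  = c g

  missing-at-both-ends : ∀ {c E e α h} → Missing x c E (x e) α → Missing y c E (y e) α →
                         h ∈ E → Adjacent e h → c h ≢ α
  missing-at-both-ends α-missingˣ _ h∈ (inj₁ xe≡xh) = α-missingˣ h∈ (sym xe≡xh)
  missing-at-both-ends _ α-missingʸ h∈ (inj₂ ye≡yh) = α-missingʸ h∈ (sym ye≡yh)

  assign-proper : ∀ {c E e α} → Proper c E → Missing x c E (x e) α → Missing y c E (y e) α →
                  Proper (assign c e α) (e ∷ E)
  assign-proper {e = e} proper α-missingˣ α-missingʸ {g} {f} g∈ f∈ g≢f adj same with g ≟ᴬ e | f ≟ᴬ e
  ... | yes refl | yes refl = g≢f refl
  ... | yes refl | no f≢e   =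
    missing-at-both-ends α-missingˣ α-missingʸ (∈-∷-≢ f∈ f≢e) adj (sym same)
  ... | no g≢e   | yes refl =
    missing-at-both-ends α-missingˣ α-missingʸ (∈-∷-≢ g∈ g≢e) (adjacent-sym adj) same
  ... | no g≢e   | no f≢e   = proper (∈-∷-≢ g∈ g≢e) (∈-∷-≢ f∈ f≢e) g≢f adj same

  edge-colouring : ∀ E → (∀ w → degreeˣ w E ≤ b) → (∀ w → degreeʸ w E ≤ b) → Σ (A → Fin b) λ c → Proper c E
  edge-colouring []      _  _  = (λ _ → fromℕ< (>-nonZero⁻¹ b)) , λ ()
  edge-colouring (e ∷ E) dˣ dʸ
    with edge-colouring E (λ w → ≤-trans (degree-∷ _≟ˣ_ x w e E) (dˣ w))
                          (λ w → ≤-trans (degree-∷ _≟ʸ_ y w e E) (dʸ w))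
  ... | c , proper
    with missing-colour _≟ˣ_ x c E (x e) (subst (_≤ b) (degree-∷-self _≟ˣ_ x e E) (dˣ (x e)))
       | missing-colour _≟ʸ_ y c E (y e) (subst (_≤ b) (degree-∷-self _≟ʸ_ y e E) (dʸ (y e)))
  ... | α , α-missingˣ | β , β-missingʸ with α ≟ᶠ β
  ...   | yes refl = assign c e α , assign-proper proper α-missingˣ β-missingʸ
  ...   | no α≢β   = assign recolour e α , assign-proper recolour-proper recolour-missing-x₀ recolour-missing-y₀
    where open KempeSwap E c proper α≢β α-missingˣ β-missingʸ

  large-matching : ∀ E → Unique E → (∀ w → degreeˣ w E ≤ b) → (∀ w → degreeʸ w E ≤ b) →
                   Σ (List A) λ E' → E' ⊆ E × AllPairs (λ e f → ¬ Adjacent e f) E' × length E ≤ b * length E'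
  large-matching E unique dˣ dʸ with edge-colouring E dˣ dʸ
  ... | c , proper with large-colour-class c E
  ...   | k , large = class , filter-⊆ colour-k? E , independent , large
    where
    colour-k? : Decidable (λ e → toℕ (c e) ≡ k)
    colour-k? e = toℕ (c e) ≟ⁿ k
    class : List A
    class = filter colour-k? E
    independent : AllPairs (λ e f → ¬ Adjacent e f) class
    independent = AllPairs-mapWith∈ (λ e∈ f∈ e≢f adj →
      let e∈E , ce≡k = ∈-filter⁻ colour-k? e∈
          f∈E , cf≡k = ∈-filter⁻ colour-k? f∈
      in proper e∈E f∈E e≢f adj (toℕ-injective (trans ce≡k (sym cf≡k))))
      (Unique.filter⁺ colour-k? unique)

Bool-alternation : ∀ {a b c d : Bool} → a ≢ b → b ≢ c → c ≢ d → a ≢ d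
Bool-alternation {a} {b} {c} {d} a≢b b≢c c≢d a≡d = Bool.not-¬ refl (trans (sym a≡d) a≡not-d)
  where
  open ≡-Reasoning
  a≡not-d : a ≡ not d
  a≡not-d = begin
    a            ≡⟨ Bool.¬-not a≢b ⟩
    not b        ≡⟨ cong not (Bool.¬-not b≢c) ⟩
    not (not c)  ≡⟨ Bool.not-involutive c ⟩
    c            ≡⟨ Bool.¬-not c≢d ⟩
    not d        ∎

_≟ᵖ_ : ∀ {n} → DecidableEquality (Path3 n)
p ≟ᵖ q = map′ (cong fromTuple) (cong toTuple) (toTuple p ≟⁴ toTuple q)
  where
  toTuple : ∀ {n} → Path3 n → Fin n × Fin n × Fin n × Fin n
  toTuple p = u' p , u p , v p , v' p
  fromTuple : ∀ {n} → Fin n × Fin n × Fin n × Fin n → Path3 n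
  fromTuple (a , b , c , d) = path a b c d
  _≟⁴_ : ∀ {n} → DecidableEquality (Fin n × Fin n × Fin n × Fin n)
  _≟⁴_ = ≡-dec _≟ᶠ_ (≡-dec _≟ᶠ_ (≡-dec _≟ᶠ_ _≟ᶠ_))

M₁∪M₂-crosses : ∀ {n} {G : Graph n} {M₁ : Matching G} {side b M₂} →
                (∀ {x y} → M M₁ x y → side x ≢ side y) → MaximalBMatching G M₁ side b M₂ →
                ∀ {x y} → InM₁₂ M₁ M₂ x y → side x ≢ side y
M₁∪M₂-crosses M₁-crosses _          (inj₁ xy∈M₁)        = M₁-crosses xy∈M₁
M₁∪M₂-crosses _          M₂-maximal (inj₂ (inj₁ xy∈M₂)) =
  let _ , _ , _ , crossing = MaximalBMatching.inE₂ M₂-maximal xy∈M₂ in crossing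
M₁∪M₂-crosses _          M₂-maximal (inj₂ (inj₂ yx∈M₂)) =
  let _ , _ , _ , crossing = MaximalBMatching.inE₂ M₂-maximal yx∈M₂ in crossing ∘ sym

module PathEnds {n} {G : Graph n} (M₁ : Matching G) (M₂ : List (Fin n × Fin n)) (side : Fin n → Bool)
         (crosses : ∀ {x y} → InM₁₂ M₁ M₂ x y → side x ≢ side y) where

  augmenting-ends-opposite : ∀ {p} → Aug3 M₁ M₂ p → side (u' p) ≢ side (v' p)
  augmenting-ends-opposite aug =
    Bool-alternation (crosses (Aug3.e₁ aug)) (crosses (Aug3.e₂ aug)) (crosses (Aug3.e₃ aug))

  -- The endpoint of p on side s, provided u' p and v' p lie on opposite sides.
  end : Bool → Path3 n → Fin n
  end s p with side (u' p) Bool.≟ s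
  ... | yes _ = u' p
  ... | no _  = v' p

  end∈verts : ∀ s p → end s p ∈ verts p
  end∈verts s p with side (u' p) Bool.≟ s
  ... | yes _ = here refl
  ... | no _  = there (there (there (here refl)))

  free-vertex-is-end : ∀ {p z} → Aug3 M₁ M₂ p → z ∈ verts p → ¬ VM M₁ z → z ≡ end (side z) p
  free-vertex-is-end {p} aug (here refl) _ with side (u' p) Bool.≟ side (u' p)
  ... | yes _       = refl
  ... | no distinct = contradiction refl distinct
  free-vertex-is-end aug (there (here refl)) free =
    contradiction (_ , Aug3.mid∈M₁ aug) free
  free-vertex-is-end aug (there (there (here refl))) free =
    contradiction (_ , Matching.sym M₁ (Aug3.mid∈M₁ aug)) free
  free-vertex-is-end {p} aug (there (there (there (here refl)))) _ with side (u' p) Bool.≟ side (v' p)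
  ... | yes same = contradiction same (augmenting-ends-opposite aug)
  ... | no _     = refl

  module Family (P : List (Path3 n)) (augmenting : All (Aug3 M₁ M₂) P)
                (load≤1 : ∀ w → VM M₁ w → load w P ≤ 1) where

    shared-vertex-free : ∀ {p q z} → p ∈ P → q ∈ P → p ≢ q → z ∈ verts p → z ∈ verts q → ¬ VM M₁ z
    shared-vertex-free {z = z} p∈ q∈ p≢q z∈p z∈q z-matched =
      1+n≰n (≤-trans (two-distinct-members (∈-filter⁺ on-z? p∈ z∈p) (∈-filter⁺ on-z? q∈ z∈q) p≢q)
                     (load≤1 z z-matched))
      where
      on-z? : Decidable (λ p → z ∈ verts p)
      on-z? p = DecMembership._∈?_ _≟ᶠ_ z (verts p)

    meeting-paths-share-end : ∀ {p q z} → p ∈ P → q ∈ P → p ≢ q → z ∈ verts p → z ∈ verts q →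
                              end false p ≡ end false q ⊎ end true p ≡ end true q
    meeting-paths-share-end {p} {q} {z} p∈ q∈ p≢q z∈p z∈q =
      same-end (side z) (trans (sym (free-vertex-is-end (All.lookup augmenting p∈) z∈p free))
                               (free-vertex-is-end (All.lookup augmenting q∈) z∈q free))
      where
      free : ¬ VM M₁ z
      free = shared-vertex-free p∈ q∈ p≢q z∈p z∈q
      same-end : ∀ s → end s p ≡ end s q → end false p ≡ end false q ⊎ end true p ≡ end true q
      same-end false = inj₁
      same-end true  = inj₂

    end-degree≤load : ∀ s w → count (λ p → end s p ≟ᶠ w) P ≤ load w P
    end-degree≤load s w = count-mono (λ p → end s p ≟ᶠ w) (λ p → DecMembership._∈?_ _≟ᶠ_ w (verts p))
      (λ {p} end≡w → subst (_∈ verts p) end≡w (end∈verts s p)) (⊆-refl {x = P})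

lemma4p3 : ∀ {n} (G : Graph n) (b : ℕ) → 0 < b →
    (M₁ : Matching G) (side : Fin n → Bool) →
    (∀ {x y} → M M₁ x y → side x ≢ side y) →
    (M₂ : List (Fin n × Fin n)) → MaximalBMatching G M₁ side b M₂ →
    (P : List (Path3 n)) → Unique P → All (Aug3 M₁ M₂) P →
    (∀ w → VM M₁ w → load w P ≤ 1) →
    (∀ w → ¬ VM M₁ w → load w P ≤ b) →
    Σ (List (Path3 n)) λ P' → P' ⊆ P × AllPairs VertexDisjoint P' × length P ≤ b * length P'
lemma4p3 G b 0<b M₁ side M₁-crosses M₂ M₂-maximal P unique augmenting load≤1 load≤b =
  let P' , P'⊆P , independent , large = large-matching P unique (end-degree≤b false) (end-degree≤b true)
  in P' , P'⊆P , AllPairs-mapWith∈ (disjoint P'⊆P) independent , large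
  where
  open PathEnds M₁ M₂ side (M₁∪M₂-crosses M₁-crosses M₂-maximal)
  open Family P augmenting load≤1
  open BipartiteEdgeColouring _≟ᵖ_ _≟ᶠ_ _≟ᶠ_ (end false) (end true) b {{>-nonZero 0<b}}

  -- V(M₁) is not decidable, but the conclusion is.
  load≤b′ : ∀ w → load w P ≤ b
  load≤b′ w = decidable-stable (load w P ≤? b) λ load≰b →
    load≰b (load≤b w (λ w-matched → load≰b (≤-trans (load≤1 w w-matched) 0<b)))

  end-degree≤b : ∀ s w → count (λ p → end s p ≟ᶠ w) P ≤ b
  end-degree≤b s w = ≤-trans (end-degree≤load s w) (load≤b′ w)

  disjoint : ∀ {P' p q} → P' ⊆ P → p ∈ P' → q ∈ P' → ¬ Adjacent p q → VertexDisjoint p q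
  disjoint P'⊆P p∈ q∈ non-adjacent (z∈p , z∈q) = non-adjacent
    (meeting-paths-share-end (Any-resp-⊆ P'⊆P p∈) (Any-resp-⊆ P'⊆P q∈) (λ { refl → non-adjacent (inj₁ refl) }) z∈p z∈q)
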